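{- Let $T$ be an h-inductive theory in a first-order language $L$. If the class $\Sigma_{T_k(T)}$ of h-maximal models of $T_k(T)$ is elementary, then it is axiomatized by $T_k(T)$.
   Context: Positive logic. A positive formula is one built from atomic formulas using $\wedge$, $\vee$ and $\exists$. An h-inductive sentence is a finite conjunction of sentences $\forall\bar x\,(\exists\bar y\,\psi(\bar x,\bar y)\rightarrow\exists\bar z\,\varphi(\bar x,\bar z))$ with $\psi,\varphi$ quantifier-free positive; an h-inductive theory is a set of such sentences. A homomorphism of $L$-structures preserves atomic formulas; it is an embedding if it preserves and reflects atomic formulas, and an immersion if it preserves and reflects positive formulas. A model $M$ of an h-inductive theory $S$ is h-maximal (for $S$) if every homomorphism from $M$ into a model of $S$ is an embedding, and positively closed (pc) if every such homomorphism is an immersion. $T_k(T)$ is the set of h-inductive $L$-sentences true in every pc model of $T$. A class of $L$-structures is elementary if it is the class of all models of some h-inductive $L$-theory. -}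

module Defs where

open import Level using (Level; _⊔_) renaming (suc to lsuc; zero to lzero)
open import Data.Nat using (ℕ; suc; _+_)
open import Data.Fin using (Fin)
open import Data.Product using (Σ; _×_; _,_)
open import Data.Sum using (_⊎_)
open import Data.Unit using (⊤)
open import Data.Empty using (⊥)
open import Data.List using (List)
open import Data.List.Relation.Unary.All using (All)
open import Data.Vec.Functional using (Vector; _++_)
open import Relation.Binary.PropositionalEquality using (_≡_)
open import Function using (_∘_)

record Language : Set₁ where
  field
    Fun    : Set
    fArity : Fun → ℕ
    Rel    : Set
    rArity : Rel → ℕ

module _ (L : Language) where
  open Language L

  data Term (n : ℕ) : Set where
    var : Fin n → Term n
    fun : (f : Fun) → (Fin (fArity f) → Term n) → Term n

  data PosFormula (n : ℕ) : Set where
    rel   : (R : Rel) → (Fin (rArity R) → Term n) → PosFormula n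
    equal : Term n → Term n → PosFormula n
    top   : PosFormula n
    bot   : PosFormula n
    _∧ᶠ_  : PosFormula n → PosFormula n → PosFormula n
    _∨ᶠ_  : PosFormula n → PosFormula n → PosFormula n
    ex    : PosFormula (suc n) → PosFormula n

  data IsAtomic {n : ℕ} : PosFormula n → Set where
    rel   : ∀ R ts → IsAtomic (rel R ts)
    equal : ∀ s t → IsAtomic (equal s t)
    top   : IsAtomic top
    bot   : IsAtomic bot

  data IsQF {n : ℕ} : PosFormula n → Set where
    atom : ∀ {φ} → IsAtomic φ → IsQF φ
    and  : ∀ {φ ψ} → IsQF φ → IsQF ψ → IsQF (φ ∧ᶠ ψ)
    or   : ∀ {φ ψ} → IsQF φ → IsQF ψ → IsQF (φ ∨ᶠ ψ)

  -- basic h-inductive sentence  ∀x̄ (∃ȳ ψ(x̄,ȳ) → ∃z̄ φ(x̄,z̄)),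
  -- |x̄| = n, |ȳ| = m, |z̄| = k, ψ, φ quantifier-free positive
  record BasicHInd : Set where
    field
      n m k : ℕ
      ψ     : PosFormula (n + m)
      ψ-qf  : IsQF ψ
      φ     : PosFormula (n + k)
      φ-qf  : IsQF φ

  -- h-inductive sentence: a finite conjunction of basic ones
  HIndSentence : Set
  HIndSentence = List BasicHInd

  Theory : Set₂
  Theory = HIndSentence → Set₁

  record Structure : Set₁ where
    field
      Carrier : Set
      funI    : (f : Fun) → (Fin (fArity f) → Carrier) → Carrier
      relI    : (R : Rel) → (Fin (rArity R) → Carrier) → Set

  open Structure

  eval : (M : Structure) {n : ℕ} → (Fin n → Carrier M) → Term n → Carrier M
  eval M a (var i)    = a i
  eval M a (fun f ts) = funI M f (λ i → eval M a (ts i))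

  Sat : (M : Structure) {n : ℕ} → PosFormula n → (Fin n → Carrier M) → Set
  Sat M (rel R ts)  a = relI M R (λ i → eval M a (ts i))
  Sat M (equal s t) a = eval M a s ≡ eval M a t
  Sat M top         a = ⊤
  Sat M bot         a = ⊥
  Sat M (φ ∧ᶠ ψ)    a = Sat M φ a × Sat M ψ a
  Sat M (φ ∨ᶠ ψ)    a = Sat M φ a ⊎ Sat M ψ a
  Sat M (ex φ)      a = Σ (Carrier M) (λ b → Sat M φ (b Data.Vec.Functional.∷ a))

  SatBasic : Structure → BasicHInd → Set
  SatBasic M σ =
    (a : Vector (Carrier M) n) →
    Σ (Vector (Carrier M) m) (λ b → Sat M ψ (a ++ b)) →
    Σ (Vector (Carrier M) k) (λ c → Sat M φ (a ++ c))
    where open BasicHInd σ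

  _⊨_ : Structure → HIndSentence → Set
  M ⊨ σ = All (SatBasic M) σ

  IsModel : Theory → Structure → Set₁
  IsModel S M = (σ : HIndSentence) → S σ → M ⊨ σ

  Preserves : (M N : Structure) → (Carrier M → Carrier N) → (PosFormula-pred : ∀ {n} → PosFormula n → Set) → Set
  Preserves M N h P = ∀ {n} (φ : PosFormula n) → P φ → (a : Fin n → Carrier M) → Sat M φ a → Sat N φ (h ∘ a)

  Reflects : (M N : Structure) → (Carrier M → Carrier N) → (PosFormula-pred : ∀ {n} → PosFormula n → Set) → Set
  Reflects M N h P = ∀ {n} (φ : PosFormula n) → P φ → (a : Fin n → Carrier M) → Sat N φ (h ∘ a) → Sat M φ a

  AnyFormula : ∀ {n} → PosFormula n → Set
  AnyFormula _ = ⊤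

  record Hom (M N : Structure) : Set where
    field
      map      : Carrier M → Carrier N
      preserve : Preserves M N map IsAtomic

  IsEmbedding : {M N : Structure} → Hom M N → Set
  IsEmbedding {M} {N} h = Reflects M N (Hom.map h) IsAtomic

  IsImmersion : {M N : Structure} → Hom M N → Set
  IsImmersion {M} {N} h =
    Preserves M N (Hom.map h) AnyFormula × Reflects M N (Hom.map h) AnyFormula

  IsHMaximal : Theory → Structure → Set₁
  IsHMaximal S M = IsModel S M × ((N : Structure) → IsModel S N → (h : Hom M N) → IsEmbedding h)

  IsPC : Theory → Structure → Set₁
  IsPC S M = IsModel S M × ((N : Structure) → IsModel S N → (h : Hom M N) → IsImmersion h)

  Tk : Theory → HIndSentence → Set₁
  Tk T σ = (M : Structure) → IsPC T M → M ⊨ σ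

  Class : Set₂
  Class = Structure → Set₁

  IsElementary : Class → Set₂
  IsElementary C = Σ Theory (λ S → (M : Structure) → (C M → IsModel S M) × (IsModel S M → C M))

  AxiomatizedBy : Class → Theory → Set₁
  AxiomatizedBy C S = (M : Structure) → (C M → IsModel S M) × (IsModel S M → C M)

module Submission where

-- One inclusion holds by definition: an h-maximal model of T_k(T) is in
-- particular a model of T_k(T).  For the converse we show S ⊆ T_k(T):
--   * T ⊆ T_k(T), so every model of T_k(T) is a model of T;
--   * an immersion is an embedding, hence every pc model of T is an
--     h-maximal model of T_k(T), i.e. lies in Σ = Mod(S);
--   * therefore each axiom of S holds in every pc model of T, i.e. S ⊆ T_k(T).
-- A model of T_k(T) then satisfies S, so it belongs to Σ.

open import Defs
open import Data.Product using (_,_; proj₁; proj₂)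
open import Data.Unit using (tt)

module _ (L : Language) where

  _⊆ᵀ_ : Theory L → Theory L → Set₁
  S ⊆ᵀ S' = (σ : HIndSentence L) → S σ → S' σ

  models-antitone : {S S' : Theory L} → S ⊆ᵀ S' →
    (M : Structure L) → IsModel L S' M → IsModel L S M
  models-antitone S⊆S' M M⊨S' σ σ∈S = M⊨S' σ (S⊆S' σ σ∈S)

  immersion⇒embedding : {M N : Structure L} (h : Hom L M N) →
    IsImmersion L h → IsEmbedding L h
  immersion⇒embedding h (_ , reflects) φ _ = reflects φ tt

  T⊆Tk : (T : Theory L) → T ⊆ᵀ Tk L T
  T⊆Tk T σ σ∈T M (M⊨T , _) = M⊨T σ σ∈T

  -- A pc model of T is an h-maximal model of T_k(T): it satisfies T_k(T) by
  -- definition, and any homomorphism into a model of T_k(T) (a fortiori of T)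
  -- is an immersion, hence an embedding.
  pc⇒hmaximal-Tk : (T : Theory L) (M : Structure L) →
    IsPC L T M → IsHMaximal L (Tk L T) M
  pc⇒hmaximal-Tk T M M-pc@(_ , immerses) =
      (λ σ σ∈Tk → σ∈Tk M M-pc)
    , λ N N⊨Tk h → immersion⇒embedding h
                     (immerses N (models-antitone (T⊆Tk T) N N⊨Tk) h)

  axioms⊆Tk : (T S : Theory L) (C : Class L) → AxiomatizedBy L C S →
    ((M : Structure L) → IsPC L T M → C M) → S ⊆ᵀ Tk L T
  axioms⊆Tk T S C C=Mod[S] pc⊆C σ σ∈S M M-pc =
    proj₁ (C=Mod[S] M) (pc⊆C M M-pc) σ σ∈S

mainTheorem10 : (L : Language) (T : Theory L) →
    IsElementary L (IsHMaximal L (Tk L T)) →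
    AxiomatizedBy L (IsHMaximal L (Tk L T)) (Tk L T)
mainTheorem10 L T (S , Σ=Mod[S]) M =
    proj₁
  , λ M⊨Tk → proj₂ (Σ=Mod[S] M) (models-antitone L S⊆Tk M M⊨Tk)
  where
    S⊆Tk : _⊆ᵀ_ L S (Tk L T)
    S⊆Tk = axioms⊆Tk L T S (IsHMaximal L (Tk L T)) Σ=Mod[S] (pc⇒hmaximal-Tk L T)
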